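{- Let $D=(V,E)$ be a finite strongly biconnected digraph without loops, let $s,t\in V$ with $s\neq t$, and let $f:V\to\{\text{robot},\text{obstacle},\text{hole}\}$ be a configuration with the robot at $s$ and at no other vertex. Then the robot can be moved from $s$ to $t$ by a finite sequence of moves if and only if $f(v)=\text{hole}$ for at least one vertex $v\in V$.
   Context: A digraph is strongly biconnected if it is strongly connected and its underlying undirected graph (edges $\{v,w\}$ for arcs $(v,w)$) is biconnected, i.e. connected without a cut vertex. A move consists of choosing an arc $(v,w)\in E$ such that $v$ holds an object (the robot or an obstacle) and $w$ holds a hole, and moving the object from $v$ to $w$ (so $v$ becomes a hole). -}

module Defs where

open import Data.Nat using (ℕ)
open import Data.Fin using (Fin)
open import Data.Product using (_×_; _,_; ∃)
open import Data.Sum using (_⊎_)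
open import Data.Empty using (⊥)
open import Data.List using (List)
open import Data.List.Membership.Propositional using (_∈_)
open import Relation.Binary.PropositionalEquality using (_≡_; _≢_)
open import Relation.Binary.Construct.Closure.ReflexiveTransitive using (Star)

record Digraph : Set where
  field
    n    : ℕ
    arcs : List (Fin n × Fin n)
open Digraph public

Arc : (D : Digraph) → Fin (n D) → Fin (n D) → Set
Arc D v w = (v , w) ∈ arcs D

Loopless : Digraph → Set
Loopless D = ∀ v w → Arc D v w → v ≢ w

StronglyConnected : Digraph → Set
StronglyConnected D = ∀ u v → Star (Arc D) u v

UEdge : (D : Digraph) → Fin (n D) → Fin (n D) → Set
UEdge D v w = Arc D v w ⊎ Arc D w v

-- undirected edge whose endpoints both differ from x (i.e. an edge of G - x)
UEdgeAvoiding : (D : Digraph) → Fin (n D) → Fin (n D) → Fin (n D) → Set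
UEdgeAvoiding D x v w = UEdge D v w × v ≢ x × w ≢ x

UConnected : Digraph → Set
UConnected D = ∀ u v → Star (UEdge D) u v

CutVertex : (D : Digraph) → Fin (n D) → Set
CutVertex D x = ∃ λ u → ∃ λ v → u ≢ x × v ≢ x × (Star (UEdgeAvoiding D x) u v → ⊥)

Biconnected : Digraph → Set
Biconnected D = UConnected D × (∀ x → CutVertex D x → ⊥)

StronglyBiconnected : Digraph → Set
StronglyBiconnected D = StronglyConnected D × Biconnected D

data Token : Set where
  robot obstacle hole : Token

Config : Digraph → Set
Config D = Fin (n D) → Token

data Move (D : Digraph) (f g : Config D) : Set where
  move : ∀ v w → Arc D v w → f v ≢ hole → f w ≡ hole →
         g v ≡ hole → g w ≡ f v →
         (∀ u → u ≢ v → u ≢ w → g u ≡ f u) → Move D f g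

Reachable : (D : Digraph) → Config D → Config D → Set
Reachable D = Star (Move D)

module Submission where

-- We follow the robot together with ONE distinguished hole, i.e. a pair
-- (r , h) of vertices, and allow two abstract steps: the hole retreats along an arc
-- v → h with v ≠ r (whatever sits at v slides into h), or the robot advances along an
-- arc r → h into the hole (which is then at r).  Every abstract run lifts to a sequence
-- of real moves (module Tracking), so it suffices to steer the pair (r , h).
--   (1) Finite walks: every walk shortens to a simple path, simple paths have fewer than
--       n arcs, hence reachability along a decidable relation on Fin n is decidable.  This
--       turns "r is not a cut vertex" into an actual path of G - r.
--   (2) Hole transport (module Transport): the hole crosses any edge a – b of G - r while the
--       robot stays at r.  Along an arc b → a it retreats directly; along an arc a → b it
--       retreats along a simple directed path b ⇝ a, and if r lies on that path, the robot
--       is driven once around the directed cycle formed by the path and the arc a → b.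
--   (3) Robot transport: along a directed path s ⇝ t, bring the hole in front of the robot
--       through G - r by (1) and (2), then step forward.
-- Theorem 9: "⇒" because the first move needs a hole (and s ≠ t forces a move); "⇐" by (3).

open import Defs
open import Data.Nat using (ℕ; zero; suc; _+_; _∸_; _≤_; _<_; z≤n; s≤s; z<s)
open import Data.Nat.Properties
open import Data.Fin using (Fin; toℕ) renaming (_≟_ to _≟F_)
open import Data.Fin.Properties using (any?; pigeonhole; toℕ<n)
open import Data.Product using (_×_; _,_; ∃)
open import Data.Product.Properties using (≡-dec)
open import Data.Sum using (_⊎_; inj₁; inj₂)
open import Data.Empty using (⊥; ⊥-elim)
open import Data.Vec.Functional using (updateAt)
open import Data.Vec.Functional.Properties using (updateAt-updates; updateAt-minimal)
open import Function using (const; _∘_)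
open import Function.Bundles using (_⇔_; mk⇔)
open import Relation.Nullary using (Dec; yes; no)
open import Relation.Nullary.Decidable using (_×-dec_; _⊎-dec_; ¬?)
open import Relation.Binary.PropositionalEquality
open import Relation.Binary.Construct.Closure.ReflexiveTransitive using (Star; ε; _◅_; _◅◅_)
import Data.List.Membership.DecPropositional as DecMembership

module FiniteWalks {N : ℕ} (R : Fin N → Fin N → Set) where

  record SimplePath (u v : Fin N) : Set where
    field
      p         : ℕ → Fin N
      k         : ℕ
      start     : p 0 ≡ u
      end       : p k ≡ v
      linked    : ∀ i → i < k → R (p i) (p (suc i))
      injective : ∀ i j → i ≤ k → j ≤ k → p i ≡ p j → i ≡ j

  occurs? : (p : ℕ → Fin N) (x : Fin N) (k : ℕ) → Dec (∃ λ j → j < suc k × p j ≡ x)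
  occurs? p x k = anyUpTo? (λ j → p j ≟F x) (suc k)

  dropPrefix : ∀ {w u v} (π : SimplePath w v) (j : ℕ) →
               j ≤ SimplePath.k π → SimplePath.p π j ≡ u → SimplePath u v
  dropPrefix π j j≤k pj≡u = record
    { p         = λ i → p (j + i)
    ; k         = k ∸ j
    ; start     = trans (cong p (+-identityʳ j)) pj≡u
    ; end       = trans (cong p (m+[n∸m]≡n j≤k)) end
    ; linked    = λ i i<k-j → subst (λ x → R (p (j + i)) (p x)) (sym (+-suc j i))
                    (linked (j + i) (subst (j + i <_) (m+[n∸m]≡n j≤k) (+-monoʳ-< j i<k-j)))
    ; injective = λ i i' i≤ i'≤ eq → +-cancelˡ-≡ j i i' (injective _ _ (shift i≤) (shift i'≤) eq)
    }
    where
    open SimplePath π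
    shift : ∀ {i} → i ≤ k ∸ j → j + i ≤ k
    shift {i} i≤ = subst (j + i ≤_) (m+[n∸m]≡n j≤k) (+-monoʳ-≤ j i≤)

  cons : ∀ {u w v} → R u w → (π : SimplePath w v) →
         (∀ j → j ≤ SimplePath.k π → SimplePath.p π j ≢ u) → SimplePath u v
  cons {u} u→w π u∉π = record
    { p = p' ; k = suc k ; start = refl ; end = end ; linked = linked' ; injective = injective' }
    where
    open SimplePath π
    p' : ℕ → Fin N
    p' zero    = u
    p' (suc i) = p i
    linked' : ∀ i → i < suc k → R (p' i) (p' (suc i))
    linked' zero    _         = subst (R u) (sym start) u→w
    linked' (suc i) (s≤s i<k) = linked i i<k
    injective' : ∀ i j → i ≤ suc k → j ≤ suc k → p' i ≡ p' j → i ≡ j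
    injective' zero    zero    _         _         _  = refl
    injective' zero    (suc j) _         (s≤s j≤k) eq = ⊥-elim (u∉π j j≤k (sym eq))
    injective' (suc i) zero    (s≤s i≤k) _         eq = ⊥-elim (u∉π i i≤k eq)
    injective' (suc i) (suc j) (s≤s i≤k) (s≤s j≤k) eq = cong suc (injective i j i≤k j≤k eq)

  simplify : ∀ {u v} → Star R u v → SimplePath u v
  simplify {v = v} ε = record
    { p = const v ; k = 0 ; start = refl ; end = refl ; linked = λ _ ()
    ; injective = λ _ _ i≤0 j≤0 _ → trans (n≤0⇒n≡0 i≤0) (sym (n≤0⇒n≡0 j≤0)) }
  simplify {u} (u→w ◅ walk) with simplify walk
  ... | π with occurs? (SimplePath.p π) u (SimplePath.k π)
  ... | yes (j , j<1+k , pj≡u) = dropPrefix π j (≤-pred j<1+k) pj≡u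
  ... | no u∉π                 = cons u→w π (λ j j≤k pj≡u → u∉π (j , s≤s j≤k , pj≡u))

  -- A simple path visits k + 1 distinct vertices, so by pigeonhole k < N.
  length<N : ∀ {u v} (π : SimplePath u v) → SimplePath.k π < N
  length<N π with SimplePath.k π <? N
  ... | yes k<N = k<N
  ... | no k≮N with pigeonhole (≰⇒> k≮N) (SimplePath.p π ∘ toℕ)
  ...   | i , j , i<j , pi≡pj = ⊥-elim (<⇒≢ i<j (SimplePath.injective π (toℕ i) (toℕ j)
                                  (≤-pred (toℕ<n i)) (≤-pred (toℕ<n j)) pi≡pj))

  data WalkWithin : ℕ → Fin N → Fin N → Set where
    here  : ∀ {k u} → WalkWithin k u u
    there : ∀ {k u w v} → R u w → WalkWithin k w v → WalkWithin (suc k) u v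

  walkWithin? : (∀ u v → Dec (R u v)) → ∀ k u v → Dec (WalkWithin k u v)
  walkWithin? R? zero u v with u ≟F v
  ... | yes refl = yes here
  ... | no u≢v   = no λ { here → u≢v refl }
  walkWithin? R? (suc k) u v with u ≟F v
  ... | yes refl = yes here
  ... | no u≢v with any? (λ w → R? u w ×-dec walkWithin? R? k w v)
  ...   | yes (w , u→w , rest) = yes (there u→w rest)
  ...   | no noStep = no λ { here → u≢v refl ; (there {w = w} u→w rest) → noStep (w , u→w , rest) }

  toStar : ∀ {k u v} → WalkWithin k u v → Star R u v
  toStar here             = ε
  toStar (there u→w rest) = u→w ◅ toStar rest

  widen : ∀ {k k' u v} → k ≤ k' → WalkWithin k u v → WalkWithin k' u v
  widen _         here             = here
  widen (s≤s k≤k') (there u→w rest) = there u→w (widen k≤k' rest)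

  fromSimplePath : ∀ {u v} (π : SimplePath u v) → WalkWithin (SimplePath.k π) u v
  fromSimplePath π = subst₂ (WalkWithin k) start end (suffix k 0 refl)
    where
    open SimplePath π
    suffix : ∀ m i → i + m ≡ k → WalkWithin m (p i) (p k)
    suffix zero    i i+0≡k = subst (λ x → WalkWithin 0 (p i) (p x)) (trans (sym (+-identityʳ i)) i+0≡k) here
    suffix (suc m) i i+m≡k = there (linked i (subst (i <_) i+m≡k (m<m+n i z<s)))
                                   (suffix m (suc i) (trans (sym (+-suc i m)) i+m≡k))

  -- Reachability along a decidable relation on a finite set is decidable:
  -- it suffices to search the walks with at most N steps.
  reachable? : (∀ u v → Dec (R u v)) → ∀ u v → Dec (Star R u v)
  reachable? R? u v with walkWithin? R? N u v
  ... | yes w = yes (toStar w)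
  ... | no ¬w = no λ walk → let π = simplify walk in ¬w (widen (<⇒≤ (length<N π)) (fromSimplePath π))

robot≢hole : robot ≢ hole
robot≢hole ()

obstacle≢hole : obstacle ≢ hole
obstacle≢hole ()

obstacle≢robot : obstacle ≢ robot
obstacle≢robot ()

module Tracking (D : Digraph) where

  Vertex : Set
  Vertex = Fin (n D)

  data Step : Vertex × Vertex → Vertex × Vertex → Set where
    holeStep  : ∀ {r h v} → Arc D v h → v ≢ r → Step (r , h) (r , v)
    robotStep : ∀ {r h}   → Arc D r h → Step (r , h) (h , r)

  _⇝_ : Vertex × Vertex → Vertex × Vertex → Set
  _⇝_ = Star Step

  Placed : Vertex → Vertex → Config D → Set
  Placed r h f = f r ≡ robot × f h ≡ hole × (∀ v → v ≢ r → f v ≢ robot)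

  slide : Config D → Vertex → Vertex → Config D
  slide f v w = updateAt (updateAt f w (const (f v))) v (const hole)

  slide-source : ∀ f v w → slide f v w v ≡ hole
  slide-source f v w = updateAt-updates v (updateAt f w (const (f v)))

  slide-target : ∀ f {v w} → w ≢ v → slide f v w w ≡ f v
  slide-target f {v} {w} w≢v = trans (updateAt-minimal w v _ w≢v) (updateAt-updates w f)

  slide-elsewhere : ∀ f {v w u} → u ≢ v → u ≢ w → slide f v w u ≡ f u
  slide-elsewhere f {v} {w} {u} u≢v u≢w =
    trans (updateAt-minimal u v _ u≢v) (updateAt-minimal u w f u≢w)

  slideMove : ∀ {f v w} → Arc D v w → f v ≢ hole → f w ≡ hole → Move D f (slide f v w)
  slideMove {f} {v} {w} v→w fv≢hole fw≡hole =
    move v w v→w fv≢hole fw≡hole (slide-source f v w) (slide-target f w≢v)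
         (λ _ → slide-elsewhere f)
    where
    w≢v : w ≢ v
    w≢v w≡v = fv≢hole (subst (λ x → f x ≡ hole) w≡v fw≡hole)

  robotAfterSlide : ∀ f {v w} u → slide f v w u ≡ robot →
                    (u ≡ w × f v ≡ robot) ⊎ (u ≢ v × f u ≡ robot)
  robotAfterSlide f {v} {w} u gu≡robot with u ≟F v
  ... | yes refl = ⊥-elim (robot≢hole (trans (sym gu≡robot) (slide-source f u w)))
  ... | no u≢v with u ≟F w
  ...   | yes refl = inj₁ (refl , trans (sym (slide-target f u≢v)) gu≡robot)
  ...   | no u≢w   = inj₂ (u≢v , trans (sym (slide-elsewhere f u≢v u≢w)) gu≡robot)

  liftStep : ∀ {r h r' h'} → Step (r , h) (r' , h') → ∀ f → Placed r h f →
             ∃ λ g → Reachable D f g × Placed r' h' g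
  liftStep (holeStep {r} {h} {v} v→h v≢r) f (fr , fh , onlyR) with f v in fv
  ... | hole     = f , ε , fr , fv , onlyR
  ... | robot    = ⊥-elim (onlyR v v≢r fv)
  ... | obstacle = slide f v h , slideMove v→h (obstacle≢hole ∘ trans (sym fv)) fh ◅ ε
                 , trans (slide-elsewhere f (v≢r ∘ sym) r≢h) fr , slide-source f v h , onlyR'
    where
    r≢h : r ≢ h
    r≢h r≡h = robot≢hole (trans (sym fr) (trans (cong f r≡h) fh))
    onlyR' : ∀ u → u ≢ r → slide f v h u ≢ robot
    onlyR' u u≢r gu≡robot with robotAfterSlide f u gu≡robot
    ... | inj₁ (_ , fv≡robot) = obstacle≢robot (trans (sym fv) fv≡robot)
    ... | inj₂ (_ , fu≡robot) = onlyR u u≢r fu≡robot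
  liftStep (robotStep {r} {h} r→h) f (fr , fh , onlyR) =
    slide f r h , slideMove r→h (robot≢hole ∘ trans (sym fr)) fh ◅ ε
    , trans (slide-target f h≢r) fr , slide-source f r h , onlyH
    where
    h≢r : h ≢ r
    h≢r h≡r = robot≢hole (trans (sym fr) (trans (cong f (sym h≡r)) fh))
    onlyH : ∀ u → u ≢ h → slide f r h u ≢ robot
    onlyH u u≢h gu≡robot with robotAfterSlide f u gu≡robot
    ... | inj₁ (u≡h , _)     = u≢h u≡h
    ... | inj₂ (u≢r , fu≡robot) = onlyR u u≢r fu≡robot

  lift : ∀ {r h r' h'} → (r , h) ⇝ (r' , h') → ∀ f → Placed r h f →
         ∃ λ g → Reachable D f g × Placed r' h' g
  lift ε f placed = f , ε , placed
  lift (step ◅ run) f placed with liftStep step f placed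
  ... | g , f↝g , placed' with lift run g placed'
  ...   | g' , g↝g' , placed'' = g' , f↝g ◅◅ g↝g' , placed''

arc? : (D : Digraph) → ∀ v w → Dec (Arc D v w)
arc? D v w = (v , w) ∈? arcs D
  where open DecMembership (≡-dec _≟F_ _≟F_)

uEdgeAvoiding? : (D : Digraph) → ∀ x v w → Dec (UEdgeAvoiding D x v w)
uEdgeAvoiding? D x v w = (arc? D v w ⊎-dec arc? D w v) ×-dec (¬? (v ≟F x) ×-dec ¬? (w ≟F x))

-- The definition of a cut vertex only forbids the absence of a path, so a path is
-- produced constructively by deciding reachability in G - r.
avoidingPath : (D : Digraph) → (∀ x → CutVertex D x → ⊥) →
               ∀ r u v → u ≢ r → v ≢ r → Star (UEdgeAvoiding D r) u v
avoidingPath D noCut r u v u≢r v≢r with FiniteWalks.reachable? (UEdgeAvoiding D r) (uEdgeAvoiding? D r) u v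
... | yes path = path
... | no noPath = ⊥-elim (noCut r (u , v , u≢r , v≢r , noPath))

module Transport (D : Digraph) (sc : StronglyConnected D) where
  open Tracking D
  open FiniteWalks (Arc D)

  module AlongSimplePath {b a : Vertex} (π : SimplePath b a) where
    open SimplePath π

    distinct : ∀ i j → i ≤ k → j ≤ k → i ≢ j → p i ≢ p j
    distinct i j i≤k j≤k i≢j = i≢j ∘ injective i j i≤k j≤k

    holeBack : ∀ r i m → i ≤ m → m ≤ k → (∀ l → i ≤ l → l ≤ m → p l ≢ r) → (r , p m) ⇝ (r , p i)
    holeBack r i m i≤m m≤k avoid with m≤n⇒m<n∨m≡n i≤m
    ... | inj₂ refl = ε
    holeBack r i (suc m) _ m<k avoid | inj₁ (s≤s i≤m) =
      holeStep (linked m m<k) (avoid m i≤m (n≤1+n m))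
      ◅ holeBack r i m i≤m (<⇒≤ m<k) (λ l i≤l l≤m → avoid l i≤l (m≤n⇒m≤1+n l≤m))

    robotForward : ∀ j m i → j < m → m ≤ k → i ≤ j → (p j , p m) ⇝ (p (suc j) , p i)
    robotForward j m i j<m m≤k i≤j =
      holeBack (p j) (suc j) m j<m m≤k
               (λ l j<l l≤m → distinct l j (≤-trans l≤m m≤k) j≤k (<⇒≢ j<l ∘ sym))
      ◅◅ robotStep (linked j (<-≤-trans j<m m≤k))
      ◅ holeBack (p (suc j)) i j i≤j j≤k
                 (λ l _ l≤j → distinct l (suc j) (≤-trans l≤j j≤k) (≤-trans j<m m≤k) (<⇒≢ (s≤s l≤j)))
      where
      j≤k : j ≤ k
      j≤k = ≤-trans (<⇒≤ j<m) m≤k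

    -- An arc p k → p 0 closes the path to a directed cycle, around which the robot can be
    -- driven with the hole returning to p k.
    module Cycle (closing : Arc D (p k) (p 0)) where

      lap : ∀ i → suc i < k → (p i , p k) ⇝ (p (suc i) , p k)
      lap i 1+i<k = robotForward i k 0 (<⇒≤ 1+i<k) ≤-refl z≤n
        ◅◅ holeStep closing (distinct k (suc i) ≤-refl (<⇒≤ 1+i<k) (<⇒≢ 1+i<k ∘ sym)) ◅ ε

      laps : ∀ i i' → i ≤ i' → i' < k → (p i , p k) ⇝ (p i' , p k)
      laps i i' i≤i' i'<k with m≤n⇒m<n∨m≡n i≤i'
      ... | inj₂ refl = ε
      laps i (suc i') _ 1+i'<k | inj₁ (s≤s i≤i') = laps i i' i≤i' (<⇒≤ 1+i'<k) ◅◅ lap i' 1+i'<k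

      wrapAround : ∀ k' → suc k' ≡ k → (p k' , p k) ⇝ (p 0 , p k)
      wrapAround k' 1+k'≡k =
        subst (λ x → (p k' , p k) ⇝ (p x , p 0)) 1+k'≡k
              (robotForward k' k 0 (subst (k' <_) 1+k'≡k ≤-refl) ≤-refl z≤n)
        ◅◅ robotStep closing ◅ ε

      -- A full turn of the robot from p j moves the hole from p k to p 0.
      rotate : ∀ j → 0 < j → j < k → (p j , p k) ⇝ (p j , p 0)
      rotate (suc j) _ 1+j<k =
        laps (suc j) (k ∸ 1) (≤-pred (subst (suc (suc j) ≤_) (sym k-1+1≡k) 1+j<k)) k-1<k
        ◅◅ wrapAround (k ∸ 1) k-1+1≡k
        ◅◅ laps 0 j z≤n j<k
        ◅◅ robotForward j k 0 j<k ≤-refl z≤n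
        where
        k-1+1≡k : suc (k ∸ 1) ≡ k
        k-1+1≡k = m+[n∸m]≡n {1} {k} (≤-trans (s≤s z≤n) 1+j<k)
        k-1<k : k ∸ 1 < k
        k-1<k = subst (k ∸ 1 <_) k-1+1≡k ≤-refl
        j<k : j < k
        j<k = <-trans (n<1+n j) 1+j<k

  holeAgainstArc : ∀ r a b → Arc D a b → a ≢ r → b ≢ r → (r , a) ⇝ (r , b)
  holeAgainstArc r a b a→b a≢r b≢r with simplify (sc b a)
  ... | π with occurs? (SimplePath.p π) r (SimplePath.k π)
  ... | no r∉π = subst₂ (λ x y → (r , x) ⇝ (r , y)) end start
                   (holeBack r 0 k z≤n ≤-refl (λ l _ l≤k pl≡r → r∉π (l , s≤s l≤k , pl≡r)))
    where open SimplePath π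
          open AlongSimplePath π
  ... | yes (j , j<1+k , pj≡r) =
          subst₂ (λ x y → (r , x) ⇝ (r , y)) end start
            (subst (λ x → (x , p k) ⇝ (x , p 0)) pj≡r (Cycle.rotate closing j 0<j j<k))
    where
    open SimplePath π
    open AlongSimplePath π
    closing : Arc D (p k) (p 0)
    closing = subst₂ (Arc D) (sym end) (sym start) a→b
    0<j : 0 < j
    0<j = n≢0⇒n>0 λ j≡0 → b≢r (trans (sym start) (trans (cong p (sym j≡0)) pj≡r))
    j<k : j < k
    j<k = ≤∧≢⇒< (≤-pred j<1+k) λ j≡k → a≢r (trans (sym end) (trans (cong p (sym j≡k)) pj≡r))

  holeAlongPath : ∀ r {h y} → Star (UEdgeAvoiding D r) h y → (r , h) ⇝ (r , y)
  holeAlongPath r ε = ε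
  holeAlongPath r ((inj₁ h→x , h≢r , x≢r) ◅ path) = holeAgainstArc r _ _ h→x h≢r x≢r ◅◅ holeAlongPath r path
  holeAlongPath r ((inj₂ x→h , _   , x≢r) ◅ path) = holeStep x→h x≢r ◅ holeAlongPath r path

  robotAlongPath : Loopless D → (∀ x → CutVertex D x → ⊥) →
                   ∀ {s t} → Star (Arc D) s t → ∀ h → h ≢ s → ∃ λ h' → (s , h) ⇝ (t , h')
  robotAlongPath _        _     ε            h _   = h , ε
  robotAlongPath loopless noCut {s} (s→x ◅ path) h h≢s
    with robotAlongPath loopless noCut path s (loopless s _ s→x)
  ... | h' , run = h' , holeAlongPath s (avoidingPath D noCut s h _ h≢s (loopless s _ s→x ∘ sym))
                        ◅◅ robotStep s→x ◅ run

theorem9 : (D : Digraph) → Loopless D → StronglyBiconnected D →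
           (s t : Fin (n D)) → s ≢ t →
           (f : Config D) → f s ≡ robot → (∀ v → v ≢ s → f v ≢ robot) →
           ((∃ λ g → Reachable D f g × g t ≡ robot) ⇔ (∃ λ v → f v ≡ hole))
theorem9 D loopless (sc , _ , noCut) s t s≢t f fs≡robot onlyS = mk⇔ needsHole reachesT
  where
  open Tracking D
  open Transport D sc

  -- The empty run leaves the robot at s ≠ t; a nonempty one starts by filling a hole of f.
  needsHole : (∃ λ g → Reachable D f g × g t ≡ robot) → ∃ λ v → f v ≡ hole
  needsHole (_ , ε , ft≡robot)                          = ⊥-elim (onlyS t (s≢t ∘ sym) ft≡robot)
  needsHole (_ , move _ w _ _ fw≡hole _ _ _ ◅ _ , _) = w , fw≡hole

  reachesT : (∃ λ v → f v ≡ hole) → ∃ λ g → Reachable D f g × g t ≡ robot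
  reachesT (h , fh≡hole) with robotAlongPath loopless noCut (sc s t) h h≢s
    where
    h≢s : h ≢ s
    h≢s h≡s = robot≢hole (trans (sym fs≡robot) (trans (cong f (sym h≡s)) fh≡hole))
  ... | _ , run with lift run f (fs≡robot , fh≡hole , onlyS)
  ...   | g , f↝g , gt≡robot , _ = g , f↝g , gt≡robot
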